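{- Let $n\ge0$ and $k\ge1$ be integers, and let $T$ be the triangle with vertices $(P_n,P_{n+k})$, $(P_{n+2k},P_{n+3k})$, $(P_{n+4k},P_{n+5k})$. Then the area of $T$ equals $4P_k^4Q_k$ if $k$ is even, and $\dfrac{P_k^2Q_k^3}{2}$ if $k$ is odd.
   Context: $P_n$ denotes the Pell numbers ($P_0=0$, $P_1=1$, $P_{n+1}=2P_n+P_{n-1}$) and $Q_n$ the Pell–Lucas numbers ($Q_0=2$, $Q_1=2$, $Q_{n+1}=2Q_n+Q_{n-1}$), i.e. $P_n=\frac{(1+\sqrt2)^n-(1-\sqrt2)^n}{2\sqrt2}$, $Q_n=(1+\sqrt2)^n+(1-\sqrt2)^n$. The area of the triangle with vertices $(x_1,y_1),(x_2,y_2),(x_3,y_3)$ is $\frac12\left|(x_2-x_1)(y_3-y_1)-(x_3-x_1)(y_2-y_1)\right|$. -}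

module Defs where

open import Data.Nat as ℕ using (ℕ; zero; suc)
open import Data.Integer as ℤ using (ℤ; +_; ∣_∣)
open import Data.Rational as ℚ using (ℚ)
open import Data.Product using (_×_; _,_)

P : ℕ → ℕ
P zero = 0
P (suc zero) = 1
P (suc (suc n)) = 2 ℕ.* P (suc n) ℕ.+ P n

Q : ℕ → ℕ
Q zero = 2
Q (suc zero) = 2
Q (suc (suc n)) = 2 ℕ.* Q (suc n) ℕ.+ Q n

Point : Set
Point = ℤ × ℤ

area : Point → Point → Point → ℚ
area (x₁ , y₁) (x₂ , y₂) (x₃ , y₃) =
  (+ ∣ (x₂ ℤ.- x₁) ℤ.* (y₃ ℤ.- y₁) ℤ.- (x₃ ℤ.- x₁) ℤ.* (y₂ ℤ.- y₁) ∣) ℚ./ 2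

pt : ℕ → ℕ → Point
pt a b = (+ P a , + P b)

-- Every sequence satisfying f (n + 2) = 2 f (n + 1) + f n obeys the addition formula
-- f (m + u) = P (m - 1) f u + P m f (u + 1).  Expanding the Pell numbers at the vertices this way
-- gives the d'Ocagne-type identity P (u + k) P (u + w) - P u P (u + k + w) = (-1)^u P k P w, so the
-- shoelace determinant of the triangle is (-1)^n P k (P (4k) - 2 P (2k)).  The doubling formulas
-- P (2m) = P m Q m and Q (2m) = Q m ² - 2 (-1)^m together with Q m ² = 8 P m ² + 4 (-1)^m turn this
-- into 8 P k ⁴ Q k for even k and P k ² Q k ³ for odd k.
module Submission where

module Pell where
  open import Defs using (P; Q)
  open import Data.Nat as ℕ using (ℕ; zero; suc)
  open import Data.Nat.DivMod using (_%_; _/_; m≡m%n+[m/n]*n)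
  import Data.Nat.Properties as ℕₚ
  import Data.Nat.Tactic.RingSolver as ℕ-Solver
  open import Data.Integer using (ℤ; +_; -_; _+_; _-_; _*_; _^_; ∣_∣; -1ℤ)
  open import Data.Integer.Properties
    using (pos-+; pos-*; -1*i≡-i; ∣-i∣≡∣i∣; abs-*; *-identityʳ; ^-distribˡ-+-*; ^-*-assoc; ^-zeroˡ)
  open import Data.Integer.Tactic.RingSolver using (solve; solve-∀)
  open import Data.List using (_∷_; [])
  open import Relation.Binary.PropositionalEquality using (_≡_; refl; trans; cong; cong₂; module ≡-Reasoning)
  open ≡-Reasoning

  pell : ℕ → ℤ
  pell m = + P m

  pellLucas : ℕ → ℤ
  pellLucas m = + Q m

  -- P (m - 1), extending the sequence backwards by P (-1) = 1
  pell₋₁ : ℕ → ℤ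
  pell₋₁ zero    = + 1
  pell₋₁ (suc m) = pell m

  record PellRecurrent (f : ℕ → ℤ) : Set where
    field step : ∀ n → f (suc (suc n)) ≡ + 2 * f (suc n) + f n
  open PellRecurrent

  recurrent-unique : ∀ {f g} → PellRecurrent f → PellRecurrent g →
                     f 0 ≡ g 0 → f 1 ≡ g 1 → ∀ n → f n ≡ g n
  recurrent-unique rf rg f0≡g0 f1≡g1 zero          = f0≡g0
  recurrent-unique rf rg f0≡g0 f1≡g1 (suc zero)    = f1≡g1
  recurrent-unique {f} {g} rf rg f0≡g0 f1≡g1 (suc (suc n)) = begin
    f (suc (suc n))         ≡⟨ step rf n ⟩
    + 2 * f (suc n) + f n   ≡⟨ cong₂ (λ x y → + 2 * x + y) (f≡g (suc n)) (f≡g n) ⟩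
    + 2 * g (suc n) + g n   ≡⟨ step rg n ⟨
    g (suc (suc n))         ∎
    where
    f≡g : ∀ n → f n ≡ g n
    f≡g = recurrent-unique rf rg f0≡g0 f1≡g1

  +-recurrent : ∀ {f g} → PellRecurrent f → PellRecurrent g → PellRecurrent (λ n → f n + g n)
  +-recurrent {f} {g} rf rg .step n =
    trans (cong₂ _+_ (step rf n) (step rg n)) (interchange (f (suc n)) (f n) (g (suc n)) (g n))
    where
    interchange : ∀ a b c d → (+ 2 * a + b) + (+ 2 * c + d) ≡ + 2 * (a + c) + (b + d)
    interchange = solve-∀

  *-recurrent : ∀ a {f} → PellRecurrent f → PellRecurrent (λ n → f n * a)
  *-recurrent a {f} rf .step n = trans (cong (_* a) (step rf n)) (distrib (f (suc n)) (f n))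
    where
    distrib : ∀ x y → (+ 2 * x + y) * a ≡ + 2 * (x * a) + y * a
    distrib x y = solve (x ∷ y ∷ a ∷ [])

  suc-recurrent : ∀ {f} → PellRecurrent f → PellRecurrent (λ n → f (suc n))
  suc-recurrent rf .step n = step rf (suc n)

  pell-recurrent : PellRecurrent pell
  pell-recurrent .step n = trans (pos-+ (2 ℕ.* P (suc n)) (P n)) (cong (_+ pell n) (pos-* 2 (P (suc n))))

  pellLucas-recurrent : PellRecurrent pellLucas
  pellLucas-recurrent .step n = trans (pos-+ (2 ℕ.* Q (suc n)) (Q n)) (cong (_+ pellLucas n) (pos-* 2 (Q (suc n))))

  pell-suc : ∀ n → pell (suc n) ≡ + 2 * pell n + pell₋₁ n
  pell-suc zero    = refl
  pell-suc (suc n) = step pell-recurrent n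

  pell₋₁-recurrent : PellRecurrent pell₋₁
  pell₋₁-recurrent .step = pell-suc

  recurrent-+ : ∀ {f} → PellRecurrent f → ∀ m u → f (m ℕ.+ u) ≡ pell₋₁ m * f u + pell m * f (suc u)
  recurrent-+ {f} rf m u =
    recurrent-unique {λ m → f (m ℕ.+ u)} (record { step = λ m → step rf (m ℕ.+ u) })
      (+-recurrent (*-recurrent (f u) pell₋₁-recurrent) (*-recurrent (f (suc u)) pell-recurrent))
      (at-0 (f u) (f (suc u))) (at-1 (f u) (f (suc u))) m
    where
    at-0 : ∀ x y → x ≡ + 1 * x + + 0 * y
    at-0 = solve-∀
    at-1 : ∀ x y → y ≡ + 0 * x + + 1 * y
    at-1 = solve-∀

  pellLucas-pell : ∀ m → pellLucas m ≡ pell (suc m) + pell₋₁ m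
  pellLucas-pell = recurrent-unique pellLucas-recurrent
    (+-recurrent (suc-recurrent pell-recurrent) pell₋₁-recurrent) refl refl

  cassini : ∀ u → pell (suc u) * pell₋₁ u - pell u * pell u ≡ -1ℤ ^ u
  cassini zero    = refl
  cassini (suc u) = begin
    pell (suc (suc u)) * pell u - pell (suc u) * pell (suc u)
      ≡⟨ alternate (step pell-recurrent u) (pell-suc u) ⟩
    - (pell (suc u) * pell₋₁ u - pell u * pell u)   ≡⟨ cong -_ (cassini u) ⟩
    - (-1ℤ ^ u)                                     ≡⟨ -1*i≡-i (-1ℤ ^ u) ⟨
    -1ℤ ^ suc u                                     ∎
    where
    alternate : ∀ {a b b′ c} → b′ ≡ + 2 * b + a → b ≡ + 2 * a + c → b′ * a - b * b ≡ - (b * c - a * a)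
    alternate {a} {c = c} refl refl = solve (a ∷ c ∷ [])

  d'Ocagne : ∀ k w u → pell (k ℕ.+ u) * pell (w ℕ.+ u) - pell u * pell ((k ℕ.+ w) ℕ.+ u)
                       ≡ -1ℤ ^ u * (pell k * pell w)
  d'Ocagne k w u = begin
    pell (k ℕ.+ u) * pell (w ℕ.+ u) - pell u * pell ((k ℕ.+ w) ℕ.+ u)
      ≡⟨ collapse (pell u) (pell (suc u)) (pell₋₁ u) (pell k) (pell₋₁ k) (pell w) (pell₋₁ w)
                  (recurrent-+ pell-recurrent k u) (recurrent-+ pell-recurrent w u)
                  (recurrent-+ pell-recurrent (k ℕ.+ w) u)
                  (recurrent-+ pell₋₁-recurrent k w) (recurrent-+ pell-recurrent k w)
                  (pell-suc w) (pell-suc u) ⟩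
    (pell (suc u) * pell₋₁ u - pell u * pell u) * (pell k * pell w)
      ≡⟨ cong (_* (pell k * pell w)) (cassini u) ⟩
    -1ℤ ^ u * (pell k * pell w) ∎
    where
    -- Written in the basis (P u, P (u + 1)), the left side is P k P w times the Cassini form.
    collapse : ∀ a b c x x′ y y′ {s t z z′ z₊ y₊} →
               s ≡ x′ * a + x * b → t ≡ y′ * a + y * b → z ≡ z′ * a + z₊ * b →
               z′ ≡ x′ * y′ + x * y → z₊ ≡ x′ * y + x * y₊ → y₊ ≡ + 2 * y + y′ → b ≡ + 2 * a + c →
               s * t - a * z ≡ (b * c - a * a) * (x * y)
    collapse a _ c x x′ y y′ refl refl refl refl refl refl refl =
      solve (a ∷ c ∷ x ∷ x′ ∷ y ∷ y′ ∷ [])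

  pell-double : ∀ m → pell (m ℕ.+ m) ≡ pell m * pellLucas m
  pell-double m = trans (recurrent-+ pell-recurrent m m) (factor (pell m) (pell (suc m)) (pell₋₁ m) (pellLucas-pell m))
    where
    factor : ∀ a b c {l} → l ≡ b + c → c * a + a * b ≡ a * l
    factor a b c refl = solve (a ∷ b ∷ c ∷ [])

  pellLucas-double : ∀ m → pellLucas (m ℕ.+ m) ≡ pellLucas m * pellLucas m - + 2 * -1ℤ ^ m
  pellLucas-double m = begin
    pellLucas (m ℕ.+ m)
      ≡⟨ recurrent-+ pellLucas-recurrent m m ⟩
    pell₋₁ m * pellLucas m + pell m * pellLucas (suc m)
      ≡⟨ square (pell m) (pell (suc m)) (pell₋₁ m) (pell-suc m) (pellLucas-pell m)
                (pellLucas-pell (suc m)) (step pell-recurrent m) ⟩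
    pellLucas m * pellLucas m - + 2 * (pell (suc m) * pell₋₁ m - pell m * pell m)
      ≡⟨ cong (λ e → pellLucas m * pellLucas m - + 2 * e) (cassini m) ⟩
    pellLucas m * pellLucas m - + 2 * -1ℤ ^ m ∎
    where
    square : ∀ a b c {b′ l l′} → b ≡ + 2 * a + c → l ≡ b + c → l′ ≡ b′ + a → b′ ≡ + 2 * b + a →
             c * l + a * l′ ≡ l * l - + 2 * (b * c - a * a)
    square a _ c refl refl refl refl = solve (a ∷ c ∷ [])

  pellLucas-square : ∀ m → pellLucas m * pellLucas m ≡ + 8 * (pell m * pell m) + + 4 * -1ℤ ^ m
  pellLucas-square m = begin
    pellLucas m * pellLucas m
      ≡⟨ square (pell m) (pell (suc m)) (pell₋₁ m) (pell-suc m) (pellLucas-pell m) ⟩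
    + 8 * (pell m * pell m) + + 4 * (pell (suc m) * pell₋₁ m - pell m * pell m)
      ≡⟨ cong (λ e → + 8 * (pell m * pell m) + + 4 * e) (cassini m) ⟩
    + 8 * (pell m * pell m) + + 4 * -1ℤ ^ m ∎
    where
    square : ∀ a b c {l} → b ≡ + 2 * a + c → l ≡ b + c → l * l ≡ + 8 * (a * a) + + 4 * (b * c - a * a)
    square a _ c refl refl = solve (a ∷ c ∷ [])

  -1^[m+2n]≡-1^m : ∀ m n → -1ℤ ^ (m ℕ.+ 2 ℕ.* n) ≡ -1ℤ ^ m
  -1^[m+2n]≡-1^m m n = begin
    -1ℤ ^ (m ℕ.+ 2 ℕ.* n)    ≡⟨ ^-distribˡ-+-* -1ℤ m (2 ℕ.* n) ⟩
    -1ℤ ^ m * -1ℤ ^ (2 ℕ.* n) ≡⟨ cong (-1ℤ ^ m *_) (^-*-assoc -1ℤ 2 n) ⟨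
    -1ℤ ^ m * (+ 1) ^ n      ≡⟨ cong (-1ℤ ^ m *_) (^-zeroˡ n) ⟩
    -1ℤ ^ m * + 1            ≡⟨ *-identityʳ (-1ℤ ^ m) ⟩
    -1ℤ ^ m                  ∎

  -1^n≡-1^[n%2] : ∀ n → -1ℤ ^ n ≡ -1ℤ ^ (n % 2)
  -1^n≡-1^[n%2] n = begin
    -1ℤ ^ n                        ≡⟨ cong (-1ℤ ^_) n≡n%2+2[n/2] ⟩
    -1ℤ ^ (n % 2 ℕ.+ 2 ℕ.* (n / 2)) ≡⟨ -1^[m+2n]≡-1^m (n % 2) (n / 2) ⟩
    -1ℤ ^ (n % 2)                  ∎
    where
    n≡n%2+2[n/2] : n ≡ n % 2 ℕ.+ 2 ℕ.* (n / 2)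
    n≡n%2+2[n/2] = trans (m≡m%n+[m/n]*n n 2) (cong (n % 2 ℕ.+_) (ℕₚ.*-comm (n / 2) 2))

  ∣-1^n∣≡1 : ∀ n → ∣ -1ℤ ^ n ∣ ≡ 1
  ∣-1^n∣≡1 zero    = refl
  ∣-1^n∣≡1 (suc n) = trans (cong ∣_∣ (-1*i≡-i (-1ℤ ^ n))) (trans (∣-i∣≡∣i∣ (-1ℤ ^ n)) (∣-1^n∣≡1 n))

  shoelace : ∀ x₁ y₁ x₂ y₂ x₃ y₃ →
             (x₂ - x₁) * (y₃ - y₁) - (x₃ - x₁) * (y₂ - y₁)
             ≡ (y₁ * x₃ - x₁ * y₃) - (y₁ * x₂ - x₁ * y₂) - (y₂ * x₃ - x₂ * y₃)
  shoelace = solve-∀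

  triangleDeterminant : ℕ → ℕ → ℤ
  triangleDeterminant n k =
    (pell (n ℕ.+ 2 ℕ.* k) - pell n) * (pell (n ℕ.+ 5 ℕ.* k) - pell (n ℕ.+ k))
    - (pell (n ℕ.+ 4 ℕ.* k) - pell n) * (pell (n ℕ.+ 3 ℕ.* k) - pell (n ℕ.+ k))

  triangleDeterminant≡ : ∀ n k → triangleDeterminant n k
                         ≡ -1ℤ ^ n * (pell k * (pell ((k ℕ.+ k) ℕ.+ (k ℕ.+ k)) - + 2 * pell (k ℕ.+ k)))
  triangleDeterminant≡ n k = begin
    (x₂ - x₁) * (y₃ - y₁) - (x₃ - x₁) * (y₂ - y₁)
      ≡⟨ shoelace x₁ y₁ x₂ y₂ x₃ y₃ ⟩
    (y₁ * x₃ - x₁ * y₃) - (y₁ * x₂ - x₁ * y₂) - (y₂ * x₃ - x₂ * y₃)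
      ≡⟨ cong₂ _-_ (cong₂ _-_ outer first) second ⟩
    ε * (pell k * pell 4k) - ε * (pell k * pell 2k) - ε * (pell k * pell 2k)
      ≡⟨ collect ε (pell k) (pell 2k) (pell 4k) ⟩
    ε * (pell k * (pell 4k - + 2 * pell 2k)) ∎
    where
    open ℕ-Solver using () renaming (solve to solveℕ)
    x₁ y₁ x₂ y₂ x₃ y₃ ε : ℤ
    x₁ = pell n
    y₁ = pell (n ℕ.+ k)
    x₂ = pell (n ℕ.+ 2 ℕ.* k)
    y₂ = pell (n ℕ.+ 3 ℕ.* k)
    x₃ = pell (n ℕ.+ 4 ℕ.* k)
    y₃ = pell (n ℕ.+ 5 ℕ.* k)
    ε = -1ℤ ^ n
    2k 4k : ℕ
    2k = k ℕ.+ k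
    4k = 2k ℕ.+ 2k

    d'Ocagne-at : ∀ k w u a b c → k ℕ.+ u ≡ a → w ℕ.+ u ≡ b → (k ℕ.+ w) ℕ.+ u ≡ c →
                  pell a * pell b - pell u * pell c ≡ -1ℤ ^ u * (pell k * pell w)
    d'Ocagne-at k w u _ _ _ refl refl refl = d'Ocagne k w u

    first : y₁ * x₂ - x₁ * y₂ ≡ ε * (pell k * pell 2k)
    first = d'Ocagne-at k (k ℕ.+ k) n (n ℕ.+ k) (n ℕ.+ 2 ℕ.* k) (n ℕ.+ 3 ℕ.* k)
                        (solveℕ (n ∷ k ∷ [])) (solveℕ (n ∷ k ∷ [])) (solveℕ (n ∷ k ∷ []))

    second : y₂ * x₃ - x₂ * y₃ ≡ ε * (pell k * pell 2k)
    second = trans (d'Ocagne-at k (k ℕ.+ k) (n ℕ.+ 2 ℕ.* k) (n ℕ.+ 3 ℕ.* k) (n ℕ.+ 4 ℕ.* k) (n ℕ.+ 5 ℕ.* k)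
                                (solveℕ (n ∷ k ∷ [])) (solveℕ (n ∷ k ∷ [])) (solveℕ (n ∷ k ∷ [])))
                   (cong (_* (pell k * pell 2k)) (-1^[m+2n]≡-1^m n k))

    outer : y₁ * x₃ - x₁ * y₃ ≡ ε * (pell k * pell 4k)
    outer = d'Ocagne-at k ((k ℕ.+ k) ℕ.+ (k ℕ.+ k)) n (n ℕ.+ k) (n ℕ.+ 4 ℕ.* k) (n ℕ.+ 5 ℕ.* k)
                        (solveℕ (n ∷ k ∷ [])) (solveℕ (n ∷ k ∷ [])) (solveℕ (n ∷ k ∷ []))

    collect : ∀ e x y z → e * (x * z) - e * (x * y) - e * (x * y) ≡ e * (x * (z - + 2 * y))
    collect = solve-∀

  triangleFactor : ℕ → ℤ
  triangleFactor k = pell k * (pell ((k ℕ.+ k) ℕ.+ (k ℕ.+ k)) - + 2 * pell (k ℕ.+ k))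

  triangleFactor≡ : ∀ k → triangleFactor k
                    ≡ pell k * pell k * pellLucas k * (pellLucas k * pellLucas k - + 2 * -1ℤ ^ k - + 2)
  triangleFactor≡ k =
    expand (pell k) (pellLucas k) (-1ℤ ^ k) (pell-double (k ℕ.+ k)) (pell-double k) (pellLucas-double k)
    where
    expand : ∀ p q e {r s t} → t ≡ r * s → r ≡ p * q → s ≡ q * q - + 2 * e →
             p * (t - + 2 * r) ≡ p * p * q * (q * q - + 2 * e - + 2)
    expand p q e refl refl refl = solve (p ∷ q ∷ e ∷ [])

  pos-^ : ∀ m n → + (m ℕ.^ n) ≡ (+ m) ^ n
  pos-^ m zero    = refl
  pos-^ m (suc n) = trans (pos-* m (m ℕ.^ n)) (cong (+ m *_) (pos-^ m n))

  triangleFactor-even : ∀ k → k % 2 ≡ 0 → triangleFactor k ≡ + (2 ℕ.* (4 ℕ.* P k ℕ.^ 4 ℕ.* Q k))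
  triangleFactor-even k k-even = begin
    triangleFactor k
      ≡⟨ triangleFactor≡ k ⟩
    p * p * q * (q * q - + 2 * -1ℤ ^ k - + 2)
      ≡⟨ cong (λ s → p * p * q * (s - + 2 * -1ℤ ^ k - + 2)) (pellLucas-square k) ⟩
    p * p * q * (+ 8 * (p * p) + + 4 * -1ℤ ^ k - + 2 * -1ℤ ^ k - + 2)
      ≡⟨ cong (λ e → p * p * q * (+ 8 * (p * p) + + 4 * e - + 2 * e - + 2)) -1^k≡1 ⟩
    p * p * q * (+ 8 * (p * p) + + 4 * + 1 - + 2 * + 1 - + 2)
      ≡⟨ simplify p q ⟩
    + 2 * (+ 4 * p ^ 4 * q)
      ≡⟨ cast (P k) (Q k) ⟨
    + (2 ℕ.* (4 ℕ.* P k ℕ.^ 4 ℕ.* Q k)) ∎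
    where
    p q : ℤ
    p = pell k
    q = pellLucas k

    -1^k≡1 : -1ℤ ^ k ≡ + 1
    -1^k≡1 = trans (-1^n≡-1^[n%2] k) (cong (-1ℤ ^_) k-even)

    simplify : ∀ p q → p * p * q * (+ 8 * (p * p) + + 4 * + 1 - + 2 * + 1 - + 2)
                       ≡ + 2 * (+ 4 * (p * (p * (p * (p * + 1)))) * q)
    simplify = solve-∀

    cast : ∀ a b → + (2 ℕ.* (4 ℕ.* a ℕ.^ 4 ℕ.* b)) ≡ + 2 * (+ 4 * (+ a) ^ 4 * + b)
    cast a b = begin
      + (2 ℕ.* (4 ℕ.* a ℕ.^ 4 ℕ.* b))  ≡⟨ pos-* 2 (4 ℕ.* a ℕ.^ 4 ℕ.* b) ⟩
      + 2 * + (4 ℕ.* a ℕ.^ 4 ℕ.* b)     ≡⟨ cong (+ 2 *_) (pos-* (4 ℕ.* a ℕ.^ 4) b) ⟩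
      + 2 * (+ (4 ℕ.* a ℕ.^ 4) * + b)   ≡⟨ cong (λ x → + 2 * (x * + b)) (pos-* 4 (a ℕ.^ 4)) ⟩
      + 2 * (+ 4 * + (a ℕ.^ 4) * + b)   ≡⟨ cong (λ x → + 2 * (+ 4 * x * + b)) (pos-^ a 4) ⟩
      + 2 * (+ 4 * (+ a) ^ 4 * + b)     ∎

  triangleFactor-odd : ∀ k → k % 2 ≡ 1 → triangleFactor k ≡ + (P k ℕ.^ 2 ℕ.* Q k ℕ.^ 3)
  triangleFactor-odd k k-odd = begin
    triangleFactor k
      ≡⟨ triangleFactor≡ k ⟩
    p * p * q * (q * q - + 2 * -1ℤ ^ k - + 2)
      ≡⟨ cong (λ e → p * p * q * (q * q - + 2 * e - + 2)) -1^k≡-1 ⟩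
    p * p * q * (q * q - + 2 * -1ℤ - + 2)
      ≡⟨ simplify p q ⟩
    p ^ 2 * q ^ 3
      ≡⟨ cong₂ _*_ (pos-^ (P k) 2) (pos-^ (Q k) 3) ⟨
    + (P k ℕ.^ 2) * + (Q k ℕ.^ 3)
      ≡⟨ pos-* (P k ℕ.^ 2) (Q k ℕ.^ 3) ⟨
    + (P k ℕ.^ 2 ℕ.* Q k ℕ.^ 3) ∎
    where
    p q : ℤ
    p = pell k
    q = pellLucas k

    -1^k≡-1 : -1ℤ ^ k ≡ -1ℤ
    -1^k≡-1 = trans (-1^n≡-1^[n%2] k) (cong (-1ℤ ^_) k-odd)

    simplify : ∀ p q → p * p * q * (q * q - + 2 * - + 1 - + 2) ≡ (p * (p * + 1)) * (q * (q * (q * + 1)))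
    simplify = solve-∀

  ∣triangleDeterminant∣ : ∀ n k → ∣ triangleDeterminant n k ∣ ≡ ∣ triangleFactor k ∣
  ∣triangleDeterminant∣ n k = begin
    ∣ triangleDeterminant n k ∣            ≡⟨ cong ∣_∣ (triangleDeterminant≡ n k) ⟩
    ∣ -1ℤ ^ n * triangleFactor k ∣          ≡⟨ abs-* (-1ℤ ^ n) (triangleFactor k) ⟩
    ∣ -1ℤ ^ n ∣ ℕ.* ∣ triangleFactor k ∣    ≡⟨ cong (ℕ._* ∣ triangleFactor k ∣) (∣-1^n∣≡1 n) ⟩
    1 ℕ.* ∣ triangleFactor k ∣              ≡⟨ ℕₚ.*-identityˡ ∣ triangleFactor k ∣ ⟩
    ∣ triangleFactor k ∣                    ∎

open import Defs
open import Data.Nat using (ℕ; _+_; _*_; _^_; _≥_)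
open import Data.Nat.DivMod using (_%_)
open import Data.Integer using (+_; ∣_∣)
import Data.Integer.Properties as ℤ
open import Data.Rational using (ℚ; _/_)
open import Data.Rational.Properties using (fromℚᵘ-cong)
open import Data.Rational.Unnormalised using (mkℚᵘ; *≡*)
open import Data.Product using (_×_; _,_)
open import Relation.Binary.PropositionalEquality using (_≡_; trans; cong)

2m/2≡m/1 : ∀ m → (+ (2 * m)) / 2 ≡ (+ m) / 1
2m/2≡m/1 m = fromℚᵘ-cong {mkℚᵘ (+ (2 * m)) 1} {mkℚᵘ (+ m) 0}
  (*≡* (trans (ℤ.*-identityʳ (+ (2 * m))) (trans (ℤ.pos-* 2 m) (ℤ.*-comm (+ 2) (+ m)))))

theorem2p5 : (n k : ℕ) → k ≥ 1 →
    (k % 2 ≡ 0 → area (pt n (n + k)) (pt (n + 2 * k) (n + 3 * k)) (pt (n + 4 * k) (n + 5 * k))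
                ≡ (+ (4 * P k ^ 4 * Q k)) / 1)
    × (k % 2 ≡ 1 → area (pt n (n + k)) (pt (n + 2 * k) (n + 3 * k)) (pt (n + 4 * k) (n + 5 * k))
                ≡ (+ (P k ^ 2 * Q k ^ 3)) / 2)
theorem2p5 n k _ =
  (λ k-even → trans (cong (λ m → + m / 2) (∣determinant∣≡ (triangleFactor-even k k-even)))
                    (2m/2≡m/1 (4 * P k ^ 4 * Q k))) ,
  (λ k-odd → cong (λ m → + m / 2) (∣determinant∣≡ (triangleFactor-odd k k-odd)))
  where
  open Pell using (triangleDeterminant; triangleFactor; triangleFactor-even; triangleFactor-odd;
                   ∣triangleDeterminant∣)

  ∣determinant∣≡ : ∀ {m} → triangleFactor k ≡ + m → ∣ triangleDeterminant n k ∣ ≡ m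
  ∣determinant∣≡ factor≡m = trans (∣triangleDeterminant∣ n k) (cong ∣_∣ factor≡m)
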